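{- Let $A = \mathbb{F}_2[[x,y]]$. Let $(X,Y)$ and $(X,Y')$ be two pairs of graded parameters of $A$ agreeing in the first component. Then for all $a \geq 0$, \[ m_{(X,Y)}(a,0) = m_{(X,Y')}(a,0). \] Likewise, if $(X,Y)$ and $(X',Y)$ are two pairs of graded parameters agreeing in the second component, then $m_{(X,Y)}(0,b) = m_{(X',Y)}(0,b)$ for all $b \geq 0$.
   Context: A pair $(X,Y)$ of elements of $A = \mathbb{F}_2[[x,y]]$ is called a pair of graded parameters if there exist invertible elements $\alpha, \beta \in A$ with $X = x\alpha^2$ and $Y = y\beta^2$; in that case $A = \mathbb{F}_2[[X,Y]]$, so every element of $A$ can be written uniquely as $\sum_{i,j\geq 0} n_{ij} X^i Y^j$ with $n_{ij}\in\mathbb{F}_2$. For such a pair and integers $a,b \geq 0$, $m_{(X,Y)}(a,b)$ denotes the continuous $\mathbb{F}_2$-linear form on $A$ sending $\sum n_{ij} X^i Y^j \mapsto n_{ab}$ (the basis of continuous linear forms dual to the monomials $X^aY^b$; in the paper $A$ is the mod-2 Hecke algebra of level 1 and these linear forms are identified with mod-2 modular forms via the pairing $(T,f)\mapsto a_1(Tf)$). -}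

module Defs where

open import Data.Nat using (ℕ; zero; suc; _+_; _∸_)
open import Data.Bool using (Bool; true; false; _∧_; _xor_)
open import Data.Product using (Σ; _×_; ∃)
open import Relation.Binary.PropositionalEquality using (_≡_)

-- Elements of A = F₂[[x,y]], represented by their coefficient families:
-- f i j is the coefficient of x^i y^j (true = 1, false = 0 in F₂).
PS : Set
PS = ℕ → ℕ → Bool

_≈_ : PS → PS → Set
f ≈ g = ∀ i j → f i j ≡ g i j

infix 4 _≈_

sumTo : ℕ → (ℕ → Bool) → Bool
sumTo zero h = h zero
sumTo (suc n) h = sumTo n h xor h (suc n)

zeroPS : PS
zeroPS _ _ = false

onePS : PS
onePS zero zero = true
onePS _ _ = false

xPS : PS
xPS (suc zero) zero = true
xPS _ _ = false

yPS : PS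
yPS zero (suc zero) = true
yPS _ _ = false

_*_ : PS → PS → PS
(f * g) i j = sumTo i λ k → sumTo j λ l → f k l ∧ g (i ∸ k) (j ∸ l)

infixl 7 _*_

_^_ : PS → ℕ → PS
f ^ zero = onePS
f ^ suc n = f * (f ^ n)

Invertible : PS → Set
Invertible α = ∃ λ β → α * β ≈ onePS

GradedParams : PS → PS → Set
GradedParams X Y =
  Σ PS λ α → Σ PS λ β →
    Invertible α × Invertible β × (X ≈ xPS * (α * α)) × (Y ≈ yPS * (β * β))

-- For graded parameters X^i Y^j has order i+j, so only terms with
-- i+j ≤ p+q contribute to the coefficient of x^p y^q; we sum over
-- i ≤ p+q, j ≤ p+q (which contains all contributing terms).
expand : (ℕ → ℕ → Bool) → PS → PS → PS
expand n X Y p q =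
  sumTo (p + q) λ i → sumTo (p + q) λ j → n i j ∧ ((X ^ i) * (Y ^ j)) p q

-- n is the coefficient family of f in the basis X^i Y^j,
-- i.e. f = Σ n_ij X^i Y^j; then m_{(X,Y)}(a,b)(f) = n a b.
IsExpansion : PS → PS → PS → (ℕ → ℕ → Bool) → Set
IsExpansion X Y f n = expand n X Y ≈ f

{-# OPTIONS --safe #-}
module Submission where

-- Setting y = 0 is a ring homomorphism F₂[[x,y]] → F₂[[x]]. It kills Y, a multiple of y, and
-- sends X = x α² to a series of order exactly one. Hence f(x,0) = Σₐ n_{a0} X(x,0)^a, and
-- substituting an order-one series is injective because X(x,0)^a = x^a + (higher terms):
-- the coefficients n_{a0} are determined by f and X alone. Setting x = 0 is symmetric.

open import Defs
open import Algebra using (CommutativeRing)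
open import Data.Bool using (Bool; true; false; _∧_; _xor_)
open import Data.Bool.Properties
  using (∧-identityʳ; ∧-zeroʳ; xor-assoc; xor-identityʳ; xor-∧-commutativeRing)
open import Data.Nat using (ℕ; zero; suc; _+_; _∸_; _≤_; _<_; z≤n; s≤s; z<s)
open import Data.Nat.Induction using (<-rec)
open import Data.Nat.Properties
  using (≤-refl; m≤n⇒m≤1+n; ≤-<-trans; m∸n≤m; ∸-monoʳ-<; n∸n≡0; +-identityʳ)
open import Data.Product using (_×_; _,_)
open import Function using (_∘_)
open import Relation.Binary.PropositionalEquality
  using (_≡_; _≗_; refl; sym; trans; cong; cong₂; module ≡-Reasoning)
open import Algebra.Properties.Group (CommutativeRing.+-group xor-∧-commutativeRing)
  renaming (∙-cancelˡ to xor-cancelˡ)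

open ≡-Reasoning

Series : Set
Series = ℕ → Bool

zeroₛ : Series
zeroₛ _ = false

oneₛ : Series
oneₛ zero    = true
oneₛ (suc _) = false

infixl 7 _⊛_
infixr 8 _^ₛ_

_⊛_ : Series → Series → Series
(s ⊛ t) m = sumTo m λ k → s k ∧ t (m ∸ k)

_^ₛ_ : Series → ℕ → Series
s ^ₛ zero  = oneₛ
s ^ₛ suc i = s ⊛ s ^ₛ i

-- c(Z) when Z 0 ≡ false: the terms with i > m do not contribute to the coefficient of tᵐ.
compose : Series → Series → Series
compose c Z m = sumTo m λ i → c i ∧ (Z ^ₛ i) m

record OrderOne (Z : Series) : Set where
  field
    constant≡0 : Z 0 ≡ false
    linear≡1   : Z 1 ≡ true

sumTo-cong : ∀ n {h h′ : ℕ → Bool} → (∀ k → k ≤ n → h k ≡ h′ k) → sumTo n h ≡ sumTo n h′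
sumTo-cong zero    h≡h′ = h≡h′ 0 z≤n
sumTo-cong (suc n) h≡h′ =
  cong₂ _xor_ (sumTo-cong n λ k k≤n → h≡h′ k (m≤n⇒m≤1+n k≤n)) (h≡h′ (suc n) ≤-refl)

sumTo-zero : ∀ n {h : ℕ → Bool} → (∀ k → k ≤ n → h k ≡ false) → sumTo n h ≡ false
sumTo-zero zero    h≡0 = h≡0 0 z≤n
sumTo-zero (suc n) h≡0 =
  cong₂ _xor_ (sumTo-zero n λ k k≤n → h≡0 k (m≤n⇒m≤1+n k≤n)) (h≡0 (suc n) ≤-refl)

sumTo-unfoldˡ : ∀ n (h : ℕ → Bool) → sumTo (suc n) h ≡ h 0 xor sumTo n (h ∘ suc)
sumTo-unfoldˡ zero    h = refl
sumTo-unfoldˡ (suc n) h =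
  trans (cong (_xor h (suc (suc n))) (sumTo-unfoldˡ n h)) (xor-assoc (h 0) _ _)

sumTo-head : ∀ n {h : ℕ → Bool} → (∀ k → k < n → h (suc k) ≡ false) → sumTo n h ≡ h 0
sumTo-head zero    _     = refl
sumTo-head (suc n) {h} tail≡0 = begin
  sumTo (suc n) h            ≡⟨ sumTo-unfoldˡ n h ⟩
  h 0 xor sumTo n (h ∘ suc)  ≡⟨ cong (h 0 xor_) (sumTo-zero n λ k k≤n → tail≡0 k (s≤s k≤n)) ⟩
  h 0 xor false              ≡⟨ xor-identityʳ (h 0) ⟩
  h 0                        ∎

sumTo-last : ∀ n {h : ℕ → Bool} → (∀ k → k < n → h k ≡ false) → sumTo n h ≡ h n
sumTo-last zero    _     = refl
sumTo-last (suc n) {h} init≡0 = cong (_xor h (suc n)) (sumTo-zero n λ k k≤n → init≡0 k (s≤s k≤n))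

⊛-cong : ∀ {s s′ t t′} → s ≗ s′ → t ≗ t′ → s ⊛ t ≗ s′ ⊛ t′
⊛-cong s≗s′ t≗t′ m = sumTo-cong m λ k _ → cong₂ _∧_ (s≗s′ k) (t≗t′ (m ∸ k))

⊛-identityˡ : ∀ s → oneₛ ⊛ s ≗ s
⊛-identityˡ s m = sumTo-head m λ _ _ → refl

⊛-identityʳ : ∀ s → s ⊛ oneₛ ≗ s
⊛-identityʳ s m = begin
  (s ⊛ oneₛ) m        ≡⟨ sumTo-last m (λ k k<m → trans (cong (s k ∧_) (oneₛ-∸ k<m)) (∧-zeroʳ (s k))) ⟩
  s m ∧ oneₛ (m ∸ m)  ≡⟨ cong (λ d → s m ∧ oneₛ d) (n∸n≡0 m) ⟩
  s m ∧ true          ≡⟨ ∧-identityʳ (s m) ⟩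
  s m                 ∎
  where
  oneₛ-∸ : ∀ {k n} → k < n → oneₛ (n ∸ k) ≡ false
  oneₛ-∸ {zero}  {suc n} _         = refl
  oneₛ-∸ {suc k} {suc n} (s≤s k<n) = oneₛ-∸ k<n

⊛-zeroˡ : ∀ {s} t → s ≗ zeroₛ → s ⊛ t ≗ zeroₛ
⊛-zeroˡ t s≗0 m = sumTo-zero m λ k _ → cong (_∧ t (m ∸ k)) (s≗0 k)

⊛-zeroʳ : ∀ s {t} → t ≗ zeroₛ → s ⊛ t ≗ zeroₛ
⊛-zeroʳ s t≗0 m = sumTo-zero m λ k _ → trans (cong (s k ∧_) (t≗0 (m ∸ k))) (∧-zeroʳ (s k))

^ₛ-vanishesBelow : ∀ {Z} → Z 0 ≡ false → ∀ a {m} → m < a → (Z ^ₛ a) m ≡ false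
^ₛ-vanishesBelow {Z} Z₀≡0 (suc a) {zero}  _ = cong (_∧ (Z ^ₛ a) 0) Z₀≡0
^ₛ-vanishesBelow {Z} Z₀≡0 (suc a) {suc m} (s≤s m<a) =
  trans (sumTo-unfoldˡ m _)
        (cong₂ _xor_ (cong (_∧ (Z ^ₛ a) (suc m)) Z₀≡0) (sumTo-zero m tail≡0))
  where
  tail≡0 : ∀ k → k ≤ m → Z (suc k) ∧ (Z ^ₛ a) (m ∸ k) ≡ false
  tail≡0 k _ = trans (cong (Z (suc k) ∧_) (^ₛ-vanishesBelow Z₀≡0 a (≤-<-trans (m∸n≤m m k) m<a)))
                     (∧-zeroʳ (Z (suc k)))

^ₛ-diagonal : ∀ {Z} → OrderOne Z → ∀ a → (Z ^ₛ a) a ≡ true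
^ₛ-diagonal     _       zero    = refl
^ₛ-diagonal {Z} Z-order (suc a) = begin
  (Z ⊛ Z ^ₛ a) (suc a)                 ≡⟨ sumTo-unfoldˡ a _ ⟩
  Z 0 ∧ (Z ^ₛ a) (suc a) xor tail      ≡⟨ cong (λ b → b ∧ (Z ^ₛ a) (suc a) xor tail) constant≡0 ⟩
  tail                                 ≡⟨ sumTo-head a tail≡0 ⟩
  Z 1 ∧ (Z ^ₛ a) a                     ≡⟨ cong₂ _∧_ linear≡1 (^ₛ-diagonal Z-order a) ⟩
  true                                 ∎
  where
  open OrderOne Z-order
  tail : Bool
  tail = sumTo a λ k → Z (suc k) ∧ (Z ^ₛ a) (a ∸ k)

  tail≡0 : ∀ k → k < a → Z (suc (suc k)) ∧ (Z ^ₛ a) (a ∸ suc k) ≡ false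
  tail≡0 k k<a = trans (cong (Z (suc (suc k)) ∧_) (^ₛ-vanishesBelow constant≡0 a (∸-monoʳ-< z<s k<a)))
                       (∧-zeroʳ _)

compose-injective : ∀ {Z c c′} → OrderOne Z → compose c Z ≗ compose c′ Z → c ≗ c′
compose-injective {Z} {c} {c′} Z-order c∘Z≗c′∘Z = <-rec (λ a → c a ≡ c′ a) agree
  where
  agree : ∀ a → (∀ {i} → i < a → c i ≡ c′ i) → c a ≡ c′ a
  agree zero    _  = trans (sym (∧-identityʳ (c 0))) (trans (c∘Z≗c′∘Z 0) (∧-identityʳ (c′ 0)))
  agree (suc a) ih = xor-cancelˡ (lower c) (c (suc a)) (c′ (suc a)) (begin
    lower c  xor c (suc a)   ≡⟨ sym (compose-unfold c) ⟩
    compose c Z (suc a)      ≡⟨ c∘Z≗c′∘Z (suc a) ⟩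
    compose c′ Z (suc a)     ≡⟨ compose-unfold c′ ⟩
    lower c′ xor c′ (suc a)  ≡⟨ cong (_xor c′ (suc a)) (sym lower-agree) ⟩
    lower c  xor c′ (suc a)  ∎)
    where
    lower : Series → Bool
    lower d = sumTo a λ i → d i ∧ (Z ^ₛ i) (suc a)

    compose-unfold : ∀ d → compose d Z (suc a) ≡ lower d xor d (suc a)
    compose-unfold d = cong (lower d xor_)
      (trans (cong (d (suc a) ∧_) (^ₛ-diagonal Z-order (suc a))) (∧-identityʳ (d (suc a))))

    lower-agree : lower c ≡ lower c′
    lower-agree = sumTo-cong a λ i i≤a → cong (_∧ (Z ^ₛ i) (suc a)) (ih (s≤s i≤a))

xAxis : PS → Series
xAxis g m = g m 0

yAxis : PS → Series
yAxis g m = g 0 m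

record IsMultiplicative (r : PS → Series) : Set where
  field
    *-homo : ∀ g h → r (g * h) ≗ r g ⊛ r h
    1-homo : r onePS ≗ oneₛ

xAxis-isMultiplicative : IsMultiplicative xAxis
xAxis-isMultiplicative = record
  { *-homo = λ _ _ _ → refl
  ; 1-homo = λ { zero → refl ; (suc _) → refl }
  }

yAxis-isMultiplicative : IsMultiplicative yAxis
yAxis-isMultiplicative = record
  { *-homo = λ _ _ _ → refl
  ; 1-homo = λ { zero → refl ; (suc _) → refl }
  }

module _ {r : PS → Series} (r-isMultiplicative : IsMultiplicative r) where
  open IsMultiplicative r-isMultiplicative

  ^-homo : ∀ g i → r (g ^ i) ≗ r g ^ₛ i
  ^-homo g zero    = 1-homo
  ^-homo g (suc i) m = trans (*-homo g (g ^ i) m) (⊛-cong (λ _ → refl) (^-homo g i) m)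

  monomial-homo : ∀ X Y i j → r (X ^ i * Y ^ j) ≗ r X ^ₛ i ⊛ r Y ^ₛ j
  monomial-homo X Y i j m = trans (*-homo (X ^ i) (Y ^ j) m) (⊛-cong (^-homo X i) (^-homo Y j) m)

expansion-xAxis : ∀ {X Y f n} → xAxis Y ≗ zeroₛ → IsExpansion X Y f n →
                  compose (λ i → n i 0) (xAxis X) ≗ xAxis f
expansion-xAxis {X} {Y} {f} {n} Y≗0 fₙ m = begin
  compose (λ i → n i 0) (xAxis X) m
    ≡⟨ cong (λ N → sumTo N λ i → n i 0 ∧ (xAxis X ^ₛ i) m) (sym (+-identityʳ m)) ⟩
  sumTo (m + 0) (λ i → n i 0 ∧ (xAxis X ^ₛ i) m)
    ≡⟨ sumTo-cong (m + 0) (λ i _ → row i) ⟨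
  expand n X Y m 0
    ≡⟨ fₙ m 0 ⟩
  f m 0
    ∎
  where
  row : ∀ i → sumTo (m + 0) (λ j → n i j ∧ (X ^ i * Y ^ j) m 0) ≡ n i 0 ∧ (xAxis X ^ₛ i) m
  row i = trans (sumTo-head (m + 0) λ j _ → trans (cong (n i (suc j) ∧_) (vanishes j)) (∧-zeroʳ _))
                (cong (n i 0 ∧_) (trans (monomial-homo xAxis-isMultiplicative X Y i 0 m) (⊛-identityʳ _ m)))
    where
    vanishes : ∀ j → (X ^ i * Y ^ suc j) m 0 ≡ false
    vanishes j = trans (monomial-homo xAxis-isMultiplicative X Y i (suc j) m)
                       (⊛-zeroʳ (xAxis X ^ₛ i) (⊛-zeroˡ (xAxis Y ^ₛ j) Y≗0) m)

expansion-yAxis : ∀ {X Y f n} → yAxis X ≗ zeroₛ → IsExpansion X Y f n →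
                  compose (n 0) (yAxis Y) ≗ yAxis f
expansion-yAxis {X} {Y} {f} {n} X≗0 fₙ m = begin
  compose (n 0) (yAxis Y) m
    ≡⟨ sumTo-cong m (λ j _ → cong (n 0 j ∧_) (leading j)) ⟨
  sumTo m (λ j → n 0 j ∧ (X ^ 0 * Y ^ j) 0 m)
    ≡⟨ sumTo-head m (λ i _ → sumTo-zero m λ j _ → vanishes i j) ⟨
  expand n X Y 0 m
    ≡⟨ fₙ 0 m ⟩
  f 0 m
    ∎
  where
  leading : ∀ j → (X ^ 0 * Y ^ j) 0 m ≡ (yAxis Y ^ₛ j) m
  leading j = trans (monomial-homo yAxis-isMultiplicative X Y 0 j m) (⊛-identityˡ (yAxis Y ^ₛ j) m)

  vanishes : ∀ i j → n (suc i) j ∧ (X ^ suc i * Y ^ j) 0 m ≡ false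
  vanishes i j = trans (cong (n (suc i) j ∧_)
                             (trans (monomial-homo yAxis-isMultiplicative X Y (suc i) j m)
                                    (⊛-zeroˡ (yAxis Y ^ₛ j) (⊛-zeroˡ (yAxis X ^ₛ i) X≗0) m)))
                       (∧-zeroʳ _)

invertible⇒constant≡1 : ∀ {α} → Invertible α → α 0 0 ≡ true
invertible⇒constant≡1 {α} (_ , αβ≈1) with α 0 0 | αβ≈1 0 0
... | true  | _  = refl
... | false | ()

gradedParams-xAxis : ∀ {X Y} → GradedParams X Y → OrderOne (xAxis X) × xAxis Y ≗ zeroₛ
gradedParams-xAxis (α , _ , α-invertible , _ , X≈xα² , Y≈yβ²) =
  record { constant≡0 = X≈xα² 0 0 ; linear≡1 = trans (X≈xα² 1 0) (cong₂ _∧_ α₀≡1 α₀≡1) } ,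
  λ m → trans (Y≈yβ² m 0) (sumTo-zero m λ { zero _ → refl ; (suc _) _ → refl })
  where
  α₀≡1 : α 0 0 ≡ true
  α₀≡1 = invertible⇒constant≡1 α-invertible

gradedParams-yAxis : ∀ {X Y} → GradedParams X Y → OrderOne (yAxis Y) × yAxis X ≗ zeroₛ
gradedParams-yAxis (_ , β , _ , β-invertible , X≈xα² , Y≈yβ²) =
  record { constant≡0 = Y≈yβ² 0 0 ; linear≡1 = trans (Y≈yβ² 0 1) (cong₂ _∧_ β₀≡1 β₀≡1) } ,
  λ m → trans (X≈xα² 0 m) (sumTo-zero m λ _ _ → refl)
  where
  β₀≡1 : β 0 0 ≡ true
  β₀≡1 = invertible⇒constant≡1 β-invertible

lemma3p6 :
    (∀ (X Y Y' : PS) → GradedParams X Y → GradedParams X Y' →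
       ∀ (a : ℕ) (f : PS) (n n' : ℕ → ℕ → Bool) →
       IsExpansion X Y f n → IsExpansion X Y' f n' → n a 0 ≡ n' a 0)
    ×
    (∀ (X X' Y : PS) → GradedParams X Y → GradedParams X' Y →
       ∀ (b : ℕ) (f : PS) (n n' : ℕ → ℕ → Bool) →
       IsExpansion X Y f n → IsExpansion X' Y f n' → n 0 b ≡ n' 0 b)
lemma3p6 =
  (λ _ _ _ XY XY′ a _ _ _ fₙ fₙ′ →
     let X-order , Y≗0 = gradedParams-xAxis XY
         _       , Y′≗0 = gradedParams-xAxis XY′
     in compose-injective X-order
          (λ m → trans (expansion-xAxis Y≗0 fₙ m) (sym (expansion-xAxis Y′≗0 fₙ′ m))) a)
  ,
  (λ _ _ _ XY X′Y b _ _ _ fₙ fₙ′ →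
     let Y-order , X≗0 = gradedParams-yAxis XY
         _       , X′≗0 = gradedParams-yAxis X′Y
     in compose-injective Y-order
          (λ m → trans (expansion-yAxis X≗0 fₙ m) (sym (expansion-yAxis X′≗0 fₙ′ m))) b)
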